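{- There is an absolute constant $c>0$ such that the following holds. Let $\mathbb{F}_q$ be a finite field, let $E\subset\mathbb{F}_q^2$, and let $R_E=\{\theta\in\mathrm{SL}_2(\mathbb{F}_q):\theta(E)=E\}$. Fix an integer $m_1\geq 1$ and let $m_0$ be the number of lines through the origin that intersect $E\setminus\{(0,0)\}$ in exactly $m_1$ points. If $m_0>8+4c$, then \[|R_E|\leq 16c^2(m_0m_1)^{3/2}.\] In particular, $|R_E|\leq 16c^2|E|^{3/2}$.
   Context: $\mathrm{SL}_2(\mathbb{F}_q)$ acts on $\mathbb{F}_q^2$ by matrix multiplication on column vectors; $\theta(E)=\{\theta x: x\in E\}$. In the paper, $c$ is the absolute constant in the Mockenhaupt–Tao point–line incidence bound $I(P,L)\leq c(|P|^{1/2}|L|^{3/4}M^{1/4}+|P|+|L|)$ for points $P$ and lines $L$ in three-dimensional space over the finite field with at most $M$ lines of $L$ in any plane. -}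

module Defs where

open import Data.Nat using (ℕ)
open import Data.Bool using (Bool; true)
open import Data.Maybe using (Maybe; just; nothing)
open import Data.Product using (Σ; ∃; _×_; _,_)
open import Data.List using (List; length)
open import Data.List.Membership.Propositional using (_∈_)
open import Data.List.Relation.Unary.Unique.Propositional using (Unique)
open import Relation.Binary.PropositionalEquality using (_≡_)
open import Relation.Binary.Definitions using (DecidableEquality)
open import Relation.Nullary using (¬_)
open import Algebra.Core using (Op₁; Op₂)
open import Algebra.Structures using (IsCommutativeRing)

record FiniteField : Set₁ where
  infixl 6 _+_ _-_
  infixl 7 _*_
  field
    Carrier  : Set
    _+_ _*_  : Op₂ Carrier
    -_       : Op₁ Carrier
    0# 1#    : Carrier
    isCommutativeRing : IsCommutativeRing _≡_ _+_ _*_ -_ 0# 1#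
    0≢1      : ¬ (0# ≡ 1#)
    inverse  : ∀ x → ¬ (x ≡ 0#) → ∃ λ y → x * y ≡ 1#
    _≟_      : DecidableEquality Carrier
    elements : List Carrier
    complete : ∀ x → x ∈ elements

  _-_ : Op₂ Carrier
  x - y = x + (- y)

HasSize : {A : Set} → (A → Set) → ℕ → Set
HasSize {A} P n =
  Σ (List A) λ xs → Unique xs × length xs ≡ n × (∀ x → (P x → x ∈ xs) × (x ∈ xs → P x))

module _ (F : FiniteField) where
  open FiniteField F

  Point : Set
  Point = Carrier × Carrier

  origin : Point
  origin = 0# , 0#

  record Mat : Set where
    constructor mat
    field a b c d : Carrier

  det : Mat → Carrier
  det (mat a b c d) = a * d - b * c

  act : Mat → Point → Point
  act (mat a b c d) (x , y) = (a * x + b * y) , (c * x + d * y)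

  Subset : Set
  Subset = Point → Bool

  FixesSet : Mat → Subset → Set
  FixesSet θ E = ∀ y → (E y ≡ true → ∃ λ x → E x ≡ true × act θ x ≡ y)
                     × ((∃ λ x → E x ≡ true × act θ x ≡ y) → E y ≡ true)

  InR : Subset → Mat → Set
  InR E θ = det θ ≡ 1# × FixesSet θ E

  Line : Set
  Line = Maybe Carrier

  OnLine : Line → Point → Set
  OnLine nothing  (x , y) = x ≡ 0#
  OnLine (just s) (x , y) = y ≡ s * x

  MeetsExactly : Subset → ℕ → Line → Set
  MeetsExactly E m₁ ℓ = HasSize (λ p → E p ≡ true × ¬ (p ≡ origin) × OnLine ℓ p) m₁

{-# OPTIONS --safe #-}
-- The elementary argument below gives |R_E|² ≤ 2N³ with N = m₀m₁, so c = 1 works and only m₀ ≥ 2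
-- is used; no incidence bound is needed.  Let S be the N points of E ∖ {0} on the m₀ lines.  SL₂
-- preserves cross(p, q) = p₁q₂ − p₂q₁, so R_E permutes S, and an element of SL₂ is determined by
-- its values on an independent pair.  Fix independent u, v ∈ S.  If every θ ∈ R_E keeps u on its
-- line, θ is determined by θu (m₁ choices) and the line of θv (m₀ choices), so |R_E| ≤ N.
-- Otherwise pick g ∈ R_E moving u off its line.  For a fibre θ₁, …, θ_k of θ ↦ θu, the map
-- (θ, φ) ↦ θ g⁻¹ θ₁⁻¹ φ g u with φ ≠ θ₁ is injective into S: θ is recovered from the pairing with u
-- and φ from the pairing with θ₁gu.  So k(k − 1) ≤ N, hence k² ≤ 2N, and summing over the N
-- possible values of θu gives |R_E|² ≤ N² · 2N.
module Submission where

open import Defs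
open import Data.Bool using (true)
open import Data.Empty using (⊥-elim)
open import Data.Maybe using (just; nothing)
open import Data.Product using (∃; ∃₂; _×_; _,_; proj₁; proj₂)
open import Data.Sum using (inj₁; inj₂)
open import Data.List using (List; []; _∷_; _++_; length; map; filter; cartesianProduct)
open import Data.List.Properties using (length-++; length-++-sucʳ; length-map)
open import Data.List.Membership.Propositional using (_∈_)
open import Data.List.Membership.Propositional.Properties
  using (∈-∃++; ∈-++⁺ˡ; ∈-++⁺ʳ; ∈-++⁻; ∈-map⁺; ∈-map⁻; ∈-filter⁻; ∈-cartesianProduct⁺; ∈-cartesianProduct⁻)
open import Data.List.Relation.Unary.All as All using (All; []; _∷_)
open import Data.List.Relation.Unary.Any using (here; there)
open import Data.List.Relation.Unary.AllPairs using ([]; _∷_)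
open import Data.List.Relation.Unary.Unique.Propositional using (Unique)
open import Data.List.Relation.Unary.Unique.Propositional.Properties using (map⁺; ++⁺; filter⁺; cartesianProduct⁺)
open import Relation.Binary.Definitions using (DecidableEquality)
open import Relation.Binary.PropositionalEquality
open import Relation.Nullary using (¬_; Dec; yes; no)
open import Algebra.Core using (Op₁; Op₂)
open import Algebra.Structures using (IsCommutativeRing)

module Counting where
  open import Data.Nat using (ℕ; zero; suc; _+_; _*_; _^_; _≤_; _<_; z≤n; s≤s)
  open import Data.Nat.Properties
  open import Data.Nat.ListAction using (sum)
  open import Data.Nat.Solver using (module +-*-Solver)
  open import Data.List.Extrema ≤-totalOrder using (max; xs≤max; argmax-all)
  open +-*-Solver using (solve; _:+_; _:*_; _:^_; _:=_; con)

  length-≤-injection : ∀ {A B : Set} (f : A → B) {xs : List A} {ys : List B} → Unique xs →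
    (∀ {x} → x ∈ xs → f x ∈ ys) →
    (∀ {x x′} → x ∈ xs → x′ ∈ xs → f x ≡ f x′ → x ≡ x′) →
    length xs ≤ length ys
  length-≤-injection f {[]} _ _ _ = z≤n
  length-≤-injection f {x ∷ xs} (x∉xs ∷ unique) into inj with ∈-∃++ (into (here refl))
  ... | ys₁ , ys₂ , refl = begin
    suc (length xs)           ≤⟨ s≤s (length-≤-injection f unique into′ (λ p q → inj (there p) (there q))) ⟩
    suc (length (ys₁ ++ ys₂)) ≡⟨ length-++-sucʳ ys₁ (f x) ys₂ ⟨
    length (ys₁ ++ f x ∷ ys₂) ∎
    where
    open ≤-Reasoning
    into′ : ∀ {x′} → x′ ∈ xs → f x′ ∈ ys₁ ++ ys₂
    into′ {x′} x′∈xs with ∈-++⁻ ys₁ (into (there x′∈xs))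
    ... | inj₁ p         = ∈-++⁺ˡ p
    ... | inj₂ (there p) = ∈-++⁺ʳ ys₁ p
    ... | inj₂ (here eq) = ⊥-elim (All.lookup x∉xs x′∈xs (sym (inj (there x′∈xs) (here refl) eq)))

  length-cartesianProduct : ∀ {A B : Set} (xs : List A) (ys : List B) →
    length (cartesianProduct xs ys) ≡ length xs * length ys
  length-cartesianProduct []       ys = refl
  length-cartesianProduct (x ∷ xs) ys = begin
    length (map (x ,_) ys ++ cartesianProduct xs ys)     ≡⟨ length-++ (map (x ,_) ys) ⟩
    length (map (x ,_) ys) + length (cartesianProduct xs ys)
      ≡⟨ cong₂ _+_ (length-map (x ,_) ys) (length-cartesianProduct xs ys) ⟩
    length ys + length xs * length ys ∎
    where open ≡-Reasoning

  sum-≤-length* : ∀ {M} ns → All (_≤ M) ns → sum ns ≤ length ns * M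
  sum-≤-length* []       []         = z≤n
  sum-≤-length* (n ∷ ns) (n≤M ∷ ns≤M) = +-mono-≤ n≤M (sum-≤-length* ns ns≤M)

  sum²-≤ : ∀ {b} ns → All (λ n → n * n ≤ b) ns → sum ns * sum ns ≤ (length ns * length ns) * b
  sum²-≤ {b} ns ns²≤b = begin
    sum ns * sum ns         ≤⟨ *-mono-≤ sum≤LM sum≤LM ⟩
    (L * M) * (L * M)       ≡⟨ solve 2 (λ L M → (L :* M) :* (L :* M) := (L :* L) :* (M :* M)) refl L M ⟩
    (L * L) * (M * M)       ≤⟨ *-monoʳ-≤ (L * L) (argmax-all (λ n → n) z≤n ns²≤b) ⟩
    (L * L) * b             ∎
    where
    open ≤-Reasoning
    L M : ℕ
    L = length ns
    M = max 0 ns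
    sum≤LM : sum ns ≤ L * M
    sum≤LM = sum-≤-length* ns (xs≤max 0 ns)

  sum-map-mono-≤ : ∀ {B : Set} {g h : B → ℕ} ys → (∀ y → g y ≤ h y) → sum (map g ys) ≤ sum (map h ys)
  sum-map-mono-≤ []       g≤h = z≤n
  sum-map-mono-≤ (y ∷ ys) g≤h = +-mono-≤ (g≤h y) (sum-map-mono-≤ ys g≤h)

  sum-map-mono-< : ∀ {B : Set} {g h : B → ℕ} {y} ys → (∀ y → g y ≤ h y) → y ∈ ys → g y < h y →
    sum (map g ys) < sum (map h ys)
  sum-map-mono-< (y ∷ ys) g≤h (here refl) gy<hy = +-mono-<-≤ gy<hy (sum-map-mono-≤ ys g≤h)
  sum-map-mono-< (y ∷ ys) g≤h (there p)   gy<hy = +-mono-≤-< (g≤h y) (sum-map-mono-< ys g≤h p gy<hy)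

  module _ {A B : Set} (_≟_ : DecidableEquality B) (f : A → B) where

    fibre : List A → B → List A
    fibre xs y = filter (λ x → f x ≟ y) xs

    length-fibre-∷ : ∀ x xs y → length (fibre xs y) ≤ length (fibre (x ∷ xs) y)
    length-fibre-∷ x xs y with f x ≟ y
    ... | yes _ = n≤1+n _
    ... | no  _ = ≤-refl

    length-fibre-∷-self : ∀ x xs → length (fibre xs (f x)) < length (fibre (x ∷ xs) (f x))
    length-fibre-∷-self x xs with f x ≟ f x
    ... | yes _   = ≤-refl
    ... | no  fx≢fx = ⊥-elim (fx≢fx refl)

    length-≤-sum-fibres : ∀ xs {ys} → (∀ {x} → x ∈ xs → f x ∈ ys) →
      length xs ≤ sum (map (λ y → length (fibre xs y)) ys)
    length-≤-sum-fibres []       into = z≤n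
    length-≤-sum-fibres (x ∷ xs) into = ≤-trans
      (s≤s (length-≤-sum-fibres xs (λ p → into (there p))))
      (sum-map-mono-< _ (length-fibre-∷ x xs) (into (here refl)) (length-fibre-∷-self x xs))

    length²-≤-fibres : ∀ {b} xs ys → (∀ {x} → x ∈ xs → f x ∈ ys) →
      (∀ y → length (fibre xs y) * length (fibre xs y) ≤ b) →
      length xs * length xs ≤ (length ys * length ys) * b
    length²-≤-fibres {b} xs ys into fibre²≤b = begin
      length xs * length xs   ≤⟨ *-mono-≤ xs≤sum xs≤sum ⟩
      sum ks * sum ks         ≤⟨ sum²-≤ ks (All.tabulate λ {k} k∈ks → fibre-bound k k∈ks) ⟩
      (length ks * length ks) * b ≡⟨ cong (λ n → (n * n) * b) (length-map _ ys) ⟩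
      (length ys * length ys) * b ∎
      where
      open ≤-Reasoning
      ks : List ℕ
      ks = map (λ y → length (fibre xs y)) ys
      xs≤sum : length xs ≤ sum ks
      xs≤sum = length-≤-sum-fibres xs into
      fibre-bound : ∀ k → k ∈ ks → k * k ≤ b
      fibre-bound k k∈ks with ∈-map⁻ _ k∈ks
      ... | y , _ , refl = fibre²≤b y

  two-distinct : ∀ {A : Set} {xs : List A} → Unique xs → 2 ≤ length xs → ∃₂ λ a b → a ∈ xs × b ∈ xs × ¬ a ≡ b
  two-distinct {xs = a ∷ b ∷ _} (a∉ ∷ _) _         = a , b , here refl , there (here refl) , All.head a∉
  two-distinct {xs = _ ∷ []}    _        (s≤s ())

  [1+r]*r≤n⇒[1+r]*[1+r]≤n+n : ∀ {r n} → 1 ≤ n → suc r * r ≤ n → suc r * suc r ≤ n + n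
  [1+r]*r≤n⇒[1+r]*[1+r]≤n+n {r} {n} 1≤n [1+r]r≤n = begin
    suc r * suc r        ≡⟨ *-suc (suc r) r ⟩
    suc r + suc r * r    ≤⟨ +-monoˡ-≤ (suc r * r) (1+r≤n r [1+r]r≤n) ⟩
    n + suc r * r        ≤⟨ +-monoʳ-≤ n [1+r]r≤n ⟩
    n + n                ∎
    where
    open ≤-Reasoning
    1+r≤n : ∀ r → suc r * r ≤ n → suc r ≤ n
    1+r≤n zero    _          = 1≤n
    1+r≤n (suc r) [2+r]r≤n = ≤-trans (m≤m*n (suc (suc r)) (suc r)) [2+r]r≤n

  module Enumeration {A : Set} {P : A → Set} {n : ℕ} (size : HasSize P n) where

    elements : List A
    elements = proj₁ size

    unique-elements : Unique elements
    unique-elements = proj₁ (proj₂ size)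

    length-elements : length elements ≡ n
    length-elements = proj₁ (proj₂ (proj₂ size))

    ∈-elements : ∀ {x} → P x → x ∈ elements
    ∈-elements {x} = proj₁ (proj₂ (proj₂ (proj₂ size)) x)

    elements-∈ : ∀ {x} → x ∈ elements → P x
    elements-∈ {x} = proj₂ (proj₂ (proj₂ (proj₂ size)) x)

  m≤n⇒m*m≤n*n*[n+n] : ∀ {m n} → 1 ≤ n → m ≤ n → m * m ≤ (n * n) * (n + n)
  m≤n⇒m*m≤n*n*[n+n] {m} {n} 1≤n m≤n = begin
    m * m              ≤⟨ *-mono-≤ m≤n m≤n ⟩
    n * n              ≡⟨ *-identityʳ (n * n) ⟨
    (n * n) * 1        ≤⟨ *-monoʳ-≤ (n * n) (≤-trans 1≤n (m≤m+n n n)) ⟩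
    (n * n) * (n + n)  ∎
    where open ≤-Reasoning

  m*m≤n*n*[n+n]⇒m^2≤2*n^3 : ∀ {m n} → m * m ≤ (n * n) * (n + n) → m ^ 2 ≤ 2 * n ^ 3
  m*m≤n*n*[n+n]⇒m^2≤2*n^3 {m} {n} = subst₂ _≤_
    (solve 1 (λ m → m :* m := m :^ 2) refl m)
    (solve 1 (λ n → (n :* n) :* (n :+ n) := con 2 :* n :^ 3) refl n)

  HasSize-image : ∀ {A B : Set} {P : A → Set} {Q : B → Set} {n} (f : A → B) (g : B → A) →
    (∀ x → g (f x) ≡ x) → (∀ y → f (g y) ≡ y) → (∀ {x} → P x → Q (f x)) → (∀ {y} → Q y → P (g y)) →
    HasSize P n → HasSize Q n
  HasSize-image {P = P} {Q} f g gf≗id fg≗id P⇒Q Q⇒P (xs , unique , len , mem) =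
    map f xs , map⁺ f-injective unique , trans (length-map f xs) len , λ y → to y , from y
    where
    f-injective : ∀ {x x′} → f x ≡ f x′ → x ≡ x′
    f-injective {x} {x′} eq = trans (sym (gf≗id x)) (trans (cong g eq) (gf≗id x′))
    to : ∀ y → Q y → y ∈ map f xs
    to y qy = subst (_∈ map f xs) (fg≗id y) (∈-map⁺ f (proj₁ (mem (g y)) (Q⇒P qy)))
    from : ∀ y → y ∈ map f xs → Q y
    from y y∈ with ∈-map⁻ f y∈
    ... | x , x∈xs , refl = P⇒Q (proj₂ (mem x) x∈xs)

  HasSize-mono : ∀ {A : Set} {P Q : A → Set} {m n} → (∀ {x} → P x → Q x) → HasSize P m → HasSize Q n → m ≤ n
  HasSize-mono P⇒Q (xs , unique , refl , memP) (ys , _ , refl , memQ) =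
    length-≤-injection (λ x → x) unique (λ {x} x∈xs → proj₁ (memQ x) (P⇒Q (proj₂ (memP x) x∈xs))) (λ _ _ eq → eq)

  module _ {I A : Set} {Q : I → A → Set} {m : ℕ} (disjoint : ∀ {i j x} → Q i x → Q j x → i ≡ j) where

    private
      Block : I → Set
      Block i = HasSize (Q i) m

      concatBlocks : ∀ is → All Block is → List A
      concatBlocks []       []                = []
      concatBlocks (i ∷ is) ((xs , _) ∷ blocks) = xs ++ concatBlocks is blocks

      length-concatBlocks : ∀ is blocks → length (concatBlocks is blocks) ≡ length is * m
      length-concatBlocks []       []                        = refl
      length-concatBlocks (i ∷ is) ((xs , _ , len , _) ∷ blocks) =
        trans (length-++ xs) (cong₂ _+_ len (length-concatBlocks is blocks))

      ∈-concatBlocks⁺ : ∀ is blocks {i x} → i ∈ is → Q i x → x ∈ concatBlocks is blocks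
      ∈-concatBlocks⁺ (i ∷ is) ((xs , _ , _ , mem) ∷ blocks) (here refl) qx = ∈-++⁺ˡ (proj₁ (mem _) qx)
      ∈-concatBlocks⁺ (i ∷ is) ((xs , _) ∷ blocks) (there j∈is) qx = ∈-++⁺ʳ xs (∈-concatBlocks⁺ is blocks j∈is qx)

      ∈-concatBlocks⁻ : ∀ is blocks {x} → x ∈ concatBlocks is blocks → ∃ λ i → i ∈ is × Q i x
      ∈-concatBlocks⁻ (i ∷ is) ((xs , _ , _ , mem) ∷ blocks) {x} x∈ with ∈-++⁻ xs x∈
      ... | inj₁ x∈xs = i , here refl , proj₂ (mem x) x∈xs
      ... | inj₂ x∈rest with ∈-concatBlocks⁻ is blocks x∈rest
      ...   | j , j∈is , qx = j , there j∈is , qx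

      unique-concatBlocks : ∀ is blocks → Unique is → Unique (concatBlocks is blocks)
      unique-concatBlocks []       []                               _              = []
      unique-concatBlocks (i ∷ is) ((xs , uxs , _ , mem) ∷ blocks) (i∉is ∷ uis) =
        ++⁺ uxs (unique-concatBlocks is blocks uis) separate
        where
        separate : ∀ {x} → ¬ (x ∈ xs × x ∈ concatBlocks is blocks)
        separate {x} (x∈xs , x∈rest) with ∈-concatBlocks⁻ is blocks x∈rest
        ... | j , j∈is , qjx = All.lookup i∉is j∈is (disjoint (proj₂ (mem x) x∈xs) qjx)

    HasSize-⋃ : ∀ {k} → HasSize (λ i → HasSize (Q i) m) k → HasSize (λ x → ∃ λ i → HasSize (Q i) m × Q i x) (k * m)
    HasSize-⋃ (is , uis , refl , mem) =
      concatBlocks is blocks , unique-concatBlocks is blocks uis , length-concatBlocks is blocks ,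
      λ x → (λ { (i , block , qx) → ∈-concatBlocks⁺ is blocks (proj₁ (mem i) block) qx })
          , (λ x∈ → let (i , i∈is , qx) = ∈-concatBlocks⁻ is blocks x∈ in i , proj₂ (mem i) i∈is , qx)
      where
      blocks : All Block is
      blocks = All.tabulate (λ {i} i∈is → proj₂ (mem i) i∈is)

-- The ring solver decides equality of coefficients by computation, so it is instantiated with
-- the coefficients ℤ, mapped into A by the canonical ring homomorphism.
module IntegerCoefficients {A : Set} {_+_ _*_ : Op₂ A} { -_ : Op₁ A } {0# 1# : A}
         (isCommutativeRing : IsCommutativeRing _≡_ _+_ _*_ -_ 0# 1#) where
  open import Algebra.Bundles using (CommutativeRing)
  open import Algebra.Solver.Ring.AlmostCommutativeRing
    using (AlmostCommutativeRing; _-Raw-AlmostCommutative⟶_; fromCommutativeRing)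
  open import Data.Maybe using (Maybe; just; nothing)
  open import Data.Nat as ℕ using (zero; suc)
  open import Data.Integer as ℤ using (ℤ; +_; -[1+_]; _⊖_)
  open import Data.Integer.Properties using ([1+m]⊖[1+n]≡m⊖n)
  import Data.Nat.Properties as ℕₚ
  open import Data.Sign as Sign using (Sign)
  open ≡-Reasoning

  commutativeRing : CommutativeRing _ _
  commutativeRing = record { isCommutativeRing = isCommutativeRing }

  open CommutativeRing commutativeRing
    using (+-assoc; +-comm; +-identityˡ; +-identityʳ; -‿inverseʳ; semiring; ring)
  open import Algebra.Properties.Semiring.Mult semiring using (×-homo-+; ×1-homo-*) renaming (_×_ to _×′_)
  open import Algebra.Properties.Ring ring
    using (-0#≈0#; -‿involutive; -‿+-comm; -‿distribˡ-*; -‿distribʳ-*)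

  signed : Sign → A → A
  signed Sign.+ x = x
  signed Sign.- x = - x

  ⟦_⟧ : ℤ → A
  ⟦ i ⟧ = signed (ℤ.sign i) (ℤ.∣ i ∣ ×′ 1#)

  ⟦◃⟧ : ∀ s n → ⟦ s ℤ.◃ n ⟧ ≡ signed s (n ×′ 1#)
  ⟦◃⟧ Sign.+ zero    = refl
  ⟦◃⟧ Sign.- zero    = sym -0#≈0#
  ⟦◃⟧ Sign.+ (suc n) = refl
  ⟦◃⟧ Sign.- (suc n) = refl

  signed-* : ∀ s t x y → signed (s Sign.* t) (x * y) ≡ signed s x * signed t y
  signed-* Sign.+ Sign.+ x y = refl
  signed-* Sign.+ Sign.- x y = -‿distribʳ-* x y
  signed-* Sign.- Sign.+ x y = -‿distribˡ-* x y
  signed-* Sign.- Sign.- x y = begin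
    x * y             ≡⟨ -‿involutive (x * y) ⟨
    - (- (x * y))     ≡⟨ cong -_ (-‿distribˡ-* x y) ⟩
    - ((- x) * y)     ≡⟨ -‿distribʳ-* (- x) y ⟩
    (- x) * (- y)     ∎

  1+-cancel : ∀ a b → (1# + a) + (- (1# + b)) ≡ a + (- b)
  1+-cancel a b = begin
    (1# + a) + (- (1# + b))          ≡⟨ cong (_+_ (1# + a)) (-‿+-comm 1# b) ⟨
    (1# + a) + ((- 1#) + (- b))      ≡⟨ cong (_+ ((- 1#) + (- b))) (+-comm 1# a) ⟩
    (a + 1#) + ((- 1#) + (- b))      ≡⟨ +-assoc a 1# ((- 1#) + (- b)) ⟩
    a + (1# + ((- 1#) + (- b)))      ≡⟨ cong (_+_ a) (+-assoc 1# (- 1#) (- b)) ⟨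
    a + ((1# + (- 1#)) + (- b))      ≡⟨ cong (λ t → a + (t + (- b))) (-‿inverseʳ 1#) ⟩
    a + (0# + (- b))                 ≡⟨ cong (_+_ a) (+-identityˡ (- b)) ⟩
    a + (- b)                        ∎

  ⟦⊖⟧ : ∀ m n → ⟦ m ⊖ n ⟧ ≡ (m ×′ 1#) + (- (n ×′ 1#))
  ⟦⊖⟧ zero    zero    = sym (trans (+-identityˡ _) -0#≈0#)
  ⟦⊖⟧ zero    (suc n) = sym (+-identityˡ _)
  ⟦⊖⟧ (suc m) zero    = sym (trans (cong (_+_ (suc m ×′ 1#)) -0#≈0#) (+-identityʳ _))
  ⟦⊖⟧ (suc m) (suc n) = begin
    ⟦ suc m ⊖ suc n ⟧                    ≡⟨ cong ⟦_⟧ ([1+m]⊖[1+n]≡m⊖n m n) ⟩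
    ⟦ m ⊖ n ⟧                            ≡⟨ ⟦⊖⟧ m n ⟩
    (m ×′ 1#) + (- (n ×′ 1#))            ≡⟨ 1+-cancel (m ×′ 1#) (n ×′ 1#) ⟨
    (suc m ×′ 1#) + (- (suc n ×′ 1#))    ∎

  ⟦+⟧ : ∀ i j → ⟦ i ℤ.+ j ⟧ ≡ ⟦ i ⟧ + ⟦ j ⟧
  ⟦+⟧ (+ m)    (+ n)    = ×-homo-+ 1# m n
  ⟦+⟧ (+ m)    -[1+ n ] = ⟦⊖⟧ m (suc n)
  ⟦+⟧ -[1+ m ] (+ n)    = trans (⟦⊖⟧ n (suc m)) (+-comm _ _)
  ⟦+⟧ -[1+ m ] -[1+ n ] = begin
    - (suc (suc (m ℕ.+ n)) ×′ 1#)            ≡⟨ cong (λ k → - (suc k ×′ 1#)) (ℕₚ.+-suc m n) ⟨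
    - ((suc m ℕ.+ suc n) ×′ 1#)              ≡⟨ cong -_ (×-homo-+ 1# (suc m) (suc n)) ⟩
    - ((suc m ×′ 1#) + (suc n ×′ 1#))        ≡⟨ -‿+-comm _ _ ⟨
    (- (suc m ×′ 1#)) + (- (suc n ×′ 1#))    ∎

  ⟦*⟧ : ∀ i j → ⟦ i ℤ.* j ⟧ ≡ ⟦ i ⟧ * ⟦ j ⟧
  ⟦*⟧ i j = begin
    ⟦ (ℤ.sign i Sign.* ℤ.sign j) ℤ.◃ (ℤ.∣ i ∣ ℕ.* ℤ.∣ j ∣) ⟧
      ≡⟨ ⟦◃⟧ (ℤ.sign i Sign.* ℤ.sign j) (ℤ.∣ i ∣ ℕ.* ℤ.∣ j ∣) ⟩
    signed (ℤ.sign i Sign.* ℤ.sign j) ((ℤ.∣ i ∣ ℕ.* ℤ.∣ j ∣) ×′ 1#)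
      ≡⟨ cong (signed (ℤ.sign i Sign.* ℤ.sign j)) (×1-homo-* ℤ.∣ i ∣ ℤ.∣ j ∣) ⟩
    signed (ℤ.sign i Sign.* ℤ.sign j) ((ℤ.∣ i ∣ ×′ 1#) * (ℤ.∣ j ∣ ×′ 1#))
      ≡⟨ signed-* (ℤ.sign i) (ℤ.sign j) _ _ ⟩
    ⟦ i ⟧ * ⟦ j ⟧ ∎

  ⟦-⟧ : ∀ i → ⟦ ℤ.- i ⟧ ≡ - ⟦ i ⟧
  ⟦-⟧ (+ zero)  = sym -0#≈0#
  ⟦-⟧ (+ suc n) = refl
  ⟦-⟧ -[1+ n ]  = sym (-‿involutive _)

  almostCommutativeRing : AlmostCommutativeRing _ _
  almostCommutativeRing = fromCommutativeRing commutativeRing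

  homomorphism : ℤ.+-*-rawRing -Raw-AlmostCommutative⟶ almostCommutativeRing
  homomorphism = record
    { ⟦_⟧ = ⟦_⟧ ; +-homo = ⟦+⟧ ; *-homo = ⟦*⟧ ; -‿homo = ⟦-⟧ ; 0-homo = refl ; 1-homo = +-identityʳ 1# }

  _≟ℤ_ : ∀ i j → Maybe (⟦ i ⟧ ≡ ⟦ j ⟧)
  i ≟ℤ j with i ℤ.≟ j
  ... | yes refl = just refl
  ... | no  _    = nothing

  open import Algebra.Solver.Ring ℤ.+-*-rawRing almostCommutativeRing homomorphism _≟ℤ_ public
    using (solve; _:+_; _:*_; :-_; _:-_; _:=_; con)

module PlaneGeometry (F : FiniteField) where
  open FiniteField F
  open IsCommutativeRing isCommutativeRing
    using (*-assoc; *-comm; *-identityˡ; *-identityʳ; +-identityʳ; zeroˡ; zeroʳ; -‿inverseʳ)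
  open import Data.Integer using (+_)
  open IntegerCoefficients isCommutativeRing using (solve; _:+_; _:*_; :-_; _:-_; _:=_; con)
  open ≡-Reasoning

  *-cancelʳ-≢0 : ∀ {x y z} → ¬ z ≡ 0# → x * z ≡ y * z → x ≡ y
  *-cancelʳ-≢0 {x} {y} {z} z≢0 xz≡yz = begin
    x               ≡⟨ *-identityʳ x ⟨
    x * 1#          ≡⟨ cong (x *_) zz⁻¹≡1 ⟨
    x * (z * z⁻¹)   ≡⟨ *-assoc x z z⁻¹ ⟨
    (x * z) * z⁻¹   ≡⟨ cong (_* z⁻¹) xz≡yz ⟩
    (y * z) * z⁻¹   ≡⟨ *-assoc y z z⁻¹ ⟩
    y * (z * z⁻¹)   ≡⟨ cong (y *_) zz⁻¹≡1 ⟩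
    y * 1#          ≡⟨ *-identityʳ y ⟩
    y               ∎
    where
    z⁻¹ : Carrier
    z⁻¹ = proj₁ (inverse z z≢0)
    zz⁻¹≡1 : z * z⁻¹ ≡ 1#
    zz⁻¹≡1 = proj₂ (inverse z z≢0)

  ≡-from-+0 : ∀ {x y c} → c ≡ 0# → x ≡ y + c → x ≡ y
  ≡-from-+0 {x} {y} refl x≡y+c = trans x≡y+c (+-identityʳ y)

  cross : Point F → Point F → Carrier
  cross (x₁ , x₂) (y₁ , y₂) = x₁ * y₂ - x₂ * y₁

  cross-self : ∀ p → cross p p ≡ 0#
  cross-self (x , y) = trans (cong (_- y * x) (*-comm x y)) (-‿inverseʳ (y * x))

  Independent : Point F → Point F → Set
  Independent p q = ¬ cross p q ≡ 0#

  dot : Point F → Point F → Carrier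
  dot (a , b) (x , y) = a * x + b * y

  dot-unique : ∀ {u v r r′} → Independent u v → dot r u ≡ dot r′ u → dot r v ≡ dot r′ v → r ≡ r′
  dot-unique {u₁ , u₂} {v₁ , v₂} {a , b} {a′ , b′} u∦v ru≡r′u rv≡r′v =
    cong₂ _,_ (*-cancelʳ-≢0 u∦v (begin
      a * Δ                                        ≡⟨ first a b ⟩
      dot (a , b) u * v₂ - dot (a , b) v * u₂      ≡⟨ cong₂ (λ s t → s * v₂ - t * u₂) ru≡r′u rv≡r′v ⟩
      dot (a′ , b′) u * v₂ - dot (a′ , b′) v * u₂  ≡⟨ first a′ b′ ⟨
      a′ * Δ                                       ∎))
    (*-cancelʳ-≢0 u∦v (begin
      b * Δ                                        ≡⟨ second a b ⟩
      dot (a , b) v * u₁ - dot (a , b) u * v₁      ≡⟨ cong₂ (λ s t → t * u₁ - s * v₁) ru≡r′u rv≡r′v ⟩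
      dot (a′ , b′) v * u₁ - dot (a′ , b′) u * v₁  ≡⟨ second a′ b′ ⟨
      b′ * Δ                                       ∎))
    where
    u v : Point F
    u = (u₁ , u₂)
    v = (v₁ , v₂)
    Δ : Carrier
    Δ = cross u v
    first : ∀ a b → a * Δ ≡ dot (a , b) u * v₂ - dot (a , b) v * u₂
    first a b = solve 6 (λ a b u₁ u₂ v₁ v₂ → a :* (u₁ :* v₂ :- u₂ :* v₁)
      := (a :* u₁ :+ b :* u₂) :* v₂ :- (a :* v₁ :+ b :* v₂) :* u₂) refl a b u₁ u₂ v₁ v₂
    second : ∀ a b → b * Δ ≡ dot (a , b) v * u₁ - dot (a , b) u * v₁
    second a b = solve 6 (λ a b u₁ u₂ v₁ v₂ → b :* (u₁ :* v₂ :- u₂ :* v₁)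
      := (a :* v₁ :+ b :* v₂) :* u₁ :- (a :* u₁ :+ b :* u₂) :* v₁) refl a b u₁ u₂ v₁ v₂

  perp : Point F → Point F
  perp (x₁ , x₂) = (- x₂ , x₁)

  cross≡dot-perp : ∀ x y → cross x y ≡ dot y (perp x)
  cross≡dot-perp (x₁ , x₂) (y₁ , y₂) =
    solve 4 (λ x₁ x₂ y₁ y₂ → x₁ :* y₂ :- x₂ :* y₁ := y₁ :* (:- x₂) :+ y₂ :* x₁) refl x₁ x₂ y₁ y₂

  cross-perp : ∀ x a → cross (perp x) (perp a) ≡ cross x a
  cross-perp (x₁ , x₂) (a₁ , a₂) =
    solve 4 (λ x₁ x₂ a₁ a₂ → (:- x₂) :* a₁ :- x₁ :* (:- a₂) := x₁ :* a₂ :- x₂ :* a₁) refl x₁ x₂ a₁ a₂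

  point-unique : ∀ {x a y y′} → Independent x a → cross x y ≡ cross x y′ → cross a y ≡ cross a y′ → y ≡ y′
  point-unique {x} {a} {y} {y′} x∦a xy≡xy′ ay≡ay′ = dot-unique
    (λ ⊥ → x∦a (trans (sym (cross-perp x a)) ⊥))
    (trans (sym (cross≡dot-perp x y)) (trans xy≡xy′ (cross≡dot-perp x y′)))
    (trans (sym (cross≡dot-perp a y)) (trans ay≡ay′ (cross≡dot-perp a y′)))

  mat-unique : ∀ {u v M M′} → Independent u v → act F M u ≡ act F M′ u → act F M v ≡ act F M′ v → M ≡ M′
  mat-unique {M = mat a b c d} {mat a′ b′ c′ d′} u∦v Mu≡M′u Mv≡M′v =
    cong₂ (λ (a , b) (c , d) → mat a b c d)
      (dot-unique u∦v (cong proj₁ Mu≡M′u) (cong proj₁ Mv≡M′v))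
      (dot-unique u∦v (cong proj₂ Mu≡M′u) (cong proj₂ Mv≡M′v))

  InSL₂ : Mat F → Set
  InSL₂ M = det F M ≡ 1#

  cross-act : ∀ M p q → cross (act F M p) (act F M q) ≡ det F M * cross p q
  cross-act (mat a b c d) (x , y) (z , w) = solve 8 (λ a b c d x y z w →
      (a :* x :+ b :* y) :* (c :* z :+ d :* w) :- (c :* x :+ d :* y) :* (a :* z :+ b :* w)
    := (a :* d :- b :* c) :* (x :* w :- y :* z)) refl a b c d x y z w

  det*-SL₂ : ∀ {M} → InSL₂ M → ∀ t → det F M * t ≡ t
  det*-SL₂ det≡1 t = trans (cong (_* t) det≡1) (*-identityˡ t)

  cross-SL₂ : ∀ {M} → InSL₂ M → ∀ p q → cross (act F M p) (act F M q) ≡ cross p q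
  cross-SL₂ {M} det≡1 p q = trans (cross-act M p q) (det*-SL₂ det≡1 (cross p q))

  adj : Mat F → Mat F
  adj (mat a b c d) = mat d (- b) (- c) a

  det-adj : ∀ M → det F (adj M) ≡ det F M
  det-adj (mat a b c d) = solve 4 (λ a b c d → d :* a :- (:- b) :* (:- c) := a :* d :- b :* c) refl a b c d

  act-adj-act : ∀ {M} → InSL₂ M → ∀ p → act F (adj M) (act F M p) ≡ p
  act-adj-act {mat a b c d} det≡1 (x , y) = cong₂ _,_
    (trans (solve 6 (λ a b c d x y → d :* (a :* x :+ b :* y) :+ (:- b) :* (c :* x :+ d :* y)
                                 := (a :* d :- b :* c) :* x) refl a b c d x y) (det*-SL₂ det≡1 x))
    (trans (solve 6 (λ a b c d x y → (:- c) :* (a :* x :+ b :* y) :+ a :* (c :* x :+ d :* y)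
                                 := (a :* d :- b :* c) :* y) refl a b c d x y) (det*-SL₂ det≡1 y))

  act-act-adj : ∀ {M} → InSL₂ M → ∀ p → act F M (act F (adj M) p) ≡ p
  act-act-adj {mat a b c d} det≡1 (x , y) = cong₂ _,_
    (trans (solve 6 (λ a b c d x y → a :* (d :* x :+ (:- b) :* y) :+ b :* ((:- c) :* x :+ a :* y)
                                 := (a :* d :- b :* c) :* x) refl a b c d x y) (det*-SL₂ det≡1 x))
    (trans (solve 6 (λ a b c d x y → c :* (d :* x :+ (:- b) :* y) :+ d :* ((:- c) :* x :+ a :* y)
                                 := (a :* d :- b :* c) :* y) refl a b c d x y) (det*-SL₂ det≡1 y))

  act-injective : ∀ {M} → InSL₂ M → ∀ {p q} → act F M p ≡ act F M q → p ≡ q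
  act-injective {M} det≡1 {p} {q} Mp≡Mq =
    trans (sym (act-adj-act det≡1 p)) (trans (cong (act F (adj M)) Mp≡Mq) (act-adj-act det≡1 q))

  act-origin : ∀ M → act F M (origin F) ≡ origin F
  act-origin (mat a b c d) = cong₂ _,_ (zero-combination a b) (zero-combination c d)
    where
    zero-combination : ∀ s t → s * 0# + t * 0# ≡ 0#
    zero-combination s t = trans (cong₂ _+_ (zeroʳ s) (zeroʳ t)) (+-identityʳ 0#)

  OnLine-cross : ∀ ℓ {p q} → OnLine F ℓ p → OnLine F ℓ q → cross p q ≡ 0#
  OnLine-cross nothing  {_ , p₂} {_ , q₂} refl refl = trans (cong₂ _-_ (zeroˡ q₂) (zeroʳ p₂)) (-‿inverseʳ 0#)
  OnLine-cross (just s) {p₁ , _} {q₁ , _} refl refl =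
    trans (cong (_- (s * p₁) * q₁) (solve 3 (λ s p₁ q₁ → p₁ :* (s :* q₁) := (s :* p₁) :* q₁) refl s p₁ q₁))
          (-‿inverseʳ _)

  cross-OnLine : ∀ ℓ {p q} → OnLine F ℓ p → ¬ p ≡ origin F → cross p q ≡ 0# → OnLine F ℓ q
  cross-OnLine nothing  {_ , p₂} {q₁ , q₂} refl p≢0 pq≡0 = sym (*-cancelʳ-≢0 p₂≢0 (≡-from-+0 pq≡0
      (solve 3 (λ p₂ q₁ q₂ → con (+ 0) :* p₂ := q₁ :* p₂ :+ (con (+ 0) :* q₂ :- p₂ :* q₁)) refl p₂ q₁ q₂)))
    where
    p₂≢0 : ¬ p₂ ≡ 0#
    p₂≢0 refl = p≢0 refl
  cross-OnLine (just s) {p₁ , _} {q₁ , q₂} refl p≢0 pq≡0 = *-cancelʳ-≢0 p₁≢0 (≡-from-+0 pq≡0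
      (solve 4 (λ s p₁ q₁ q₂ → q₂ :* p₁ := (s :* q₁) :* p₁ :+ (p₁ :* q₂ :- (s :* p₁) :* q₁)) refl s p₁ q₁ q₂))
    where
    p₁≢0 : ¬ p₁ ≡ 0#
    p₁≢0 refl = p≢0 (cong (0# ,_) (zeroʳ s))

  OnLine-unique : ∀ ℓ ℓ′ {p} → OnLine F ℓ p → OnLine F ℓ′ p → ¬ p ≡ origin F → ℓ ≡ ℓ′
  OnLine-unique nothing  nothing  _    _    _   = refl
  OnLine-unique nothing  (just t) refl refl p≢0 = ⊥-elim (p≢0 (cong (0# ,_) (zeroʳ t)))
  OnLine-unique (just s) nothing  refl refl p≢0 = ⊥-elim (p≢0 (cong (0# ,_) (zeroʳ s)))
  OnLine-unique (just s) (just t) {p₁ , _} refl sp₁≡tp₁ p≢0 = cong just (*-cancelʳ-≢0 p₁≢0 sp₁≡tp₁)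
    where
    p₁≢0 : ¬ p₁ ≡ 0#
    p₁≢0 refl = p≢0 (cong (0# ,_) (zeroʳ s))

  lineOf : Point F → Line F
  lineOf (x , y) with x ≟ 0#
  ... | yes _   = nothing
  ... | no  x≢0 = just (y * proj₁ (inverse x x≢0))

  OnLine-lineOf : ∀ p → OnLine F (lineOf p) p
  OnLine-lineOf (x , y) with x ≟ 0#
  ... | yes x≡0 = x≡0
  ... | no  x≢0 = begin
    y                ≡⟨ *-identityʳ y ⟨
    y * 1#           ≡⟨ cong (y *_) (proj₂ (inverse x x≢0)) ⟨
    y * (x * x⁻¹)    ≡⟨ solve 3 (λ x y x⁻¹ → y :* (x :* x⁻¹) := (y :* x⁻¹) :* x) refl x y x⁻¹ ⟩
    (y * x⁻¹) * x    ∎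
    where x⁻¹ = proj₁ (inverse x x≢0)

  act-≢origin : ∀ {M} → InSL₂ M → ∀ {p} → ¬ p ≡ origin F → ¬ act F M p ≡ origin F
  act-≢origin {M} det≡1 p≢0 Mp≡0 = p≢0 (act-injective det≡1 (trans Mp≡0 (sym (act-origin M))))

  OnLine-act : ∀ {M ℓ ℓ′ p q} → InSL₂ M → OnLine F ℓ p → ¬ p ≡ origin F → OnLine F ℓ′ (act F M p) →
    OnLine F ℓ q → OnLine F ℓ′ (act F M q)
  OnLine-act {ℓ = ℓ} {ℓ′} {p} {q} det≡1 p∈ℓ p≢0 Mp∈ℓ′ q∈ℓ = cross-OnLine ℓ′ Mp∈ℓ′ (act-≢origin det≡1 p≢0)
    (trans (cross-SL₂ det≡1 p q) (OnLine-cross ℓ p∈ℓ q∈ℓ))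

  SL₂-≡-from-point-and-direction : ∀ {u v M M′} → Independent u v → InSL₂ M → InSL₂ M′ →
    act F M u ≡ act F M′ u → cross (act F M v) (act F M′ v) ≡ 0# → M ≡ M′
  SL₂-≡-from-point-and-direction {u} {v} {M} {M′} u∦v det≡1 det′≡1 Mu≡M′u Mv∥M′v = mat-unique u∦v Mu≡M′u
    (point-unique (λ ⊥ → u∦v (trans (sym (cross-SL₂ det≡1 u v)) ⊥))
      (begin
        cross (act F M u) (act F M v)   ≡⟨ cross-SL₂ det≡1 u v ⟩
        cross u v                       ≡⟨ cross-SL₂ det′≡1 u v ⟨
        cross (act F M′ u) (act F M′ v) ≡⟨ cong (λ w → cross w (act F M′ v)) Mu≡M′u ⟨
        cross (act F M u) (act F M′ v)  ∎)
      (trans (cross-self (act F M v)) (sym Mv∥M′v)))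

  module Fibre {u z : Point F} (u∦z : Independent u z) (y : Point F) where

    InFibre : Mat F → Set
    InFibre θ = InSL₂ θ × act F θ u ≡ y

    cross-fibre : ∀ {θ} → InFibre θ → ∀ p → cross y (act F θ p) ≡ cross u p
    cross-fibre (det≡1 , refl) p = cross-SL₂ det≡1 u p

    module _ {θ₁ : Mat F} (θ₁∈ : InFibre θ₁) where

      determined-by-cross : ∀ {φ φ′} → InFibre φ → InFibre φ′ →
        cross (act F θ₁ z) (act F φ z) ≡ cross (act F θ₁ z) (act F φ′ z) → φ ≡ φ′
      determined-by-cross φ∈@(_ , φu≡y) φ′∈@(_ , φ′u≡y) eq = mat-unique u∦z (trans φu≡y (sym φ′u≡y))
        (point-unique (λ ⊥ → u∦z (trans (sym (cross-fibre θ₁∈ z)) ⊥))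
          (trans (cross-fibre φ∈ z) (sym (cross-fibre φ′∈ z))) eq)

      pair-injective : ∀ {h : Point F → Point F} → (∀ p q → cross (h p) (h q) ≡ cross p q) →
        h (act F θ₁ z) ≡ u → ∀ {θ θ′ φ φ′} → InFibre θ → InFibre θ′ → InFibre φ → InFibre φ′ → ¬ φ ≡ θ₁ →
        act F θ (h (act F φ z)) ≡ act F θ′ (h (act F φ′ z)) → θ ≡ θ′ × φ ≡ φ′
      pair-injective {h} h-cross hθ₁z≡u {θ} {θ′} {φ} {φ′} θ∈ θ′∈ φ∈ φ′∈ φ≢θ₁ eq = θ≡θ′ , φ≡φ′
        where
        cross-u-h : ∀ w → cross u (h w) ≡ cross (act F θ₁ z) w
        cross-u-h w = trans (cong (λ t → cross t (h w)) (sym hθ₁z≡u)) (h-cross _ w)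
        P : Point F
        P = h (act F φ z)
        uP≡uP′ : cross u P ≡ cross u (h (act F φ′ z))
        uP≡uP′ = trans (sym (cross-fibre θ∈ P)) (trans (cong (cross y) eq) (cross-fibre θ′∈ _))
        φ≡φ′ : φ ≡ φ′
        φ≡φ′ = determined-by-cross φ∈ φ′∈ (trans (sym (cross-u-h _)) (trans uP≡uP′ (cross-u-h _)))
        u∦P : Independent u P
        u∦P uP≡0 = φ≢θ₁ (determined-by-cross φ∈ θ₁∈
          (trans (sym (cross-u-h _)) (trans uP≡0 (sym (cross-self _)))))
        θ≡θ′ : θ ≡ θ′
        θ≡θ′ = mat-unique u∦P (trans (proj₂ θ∈) (sym (proj₂ θ′∈)))
          (trans eq (cong (λ ψ → act F θ′ (h (act F ψ z))) (sym φ≡φ′)))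

module Symmetries (F : FiniteField) (E : Subset F) where
  open FiniteField F using (0#; _≟_)
  open PlaneGeometry F
  open Counting
  open import Data.Bool.Properties using (⇔→≡)
  open import Function.Bundles using (mk⇔)
  open import Data.Nat using (ℕ; _+_; _*_; _^_; _≤_; z≤n; s≤s)
  open import Data.Nat.Properties using (<⇒≢; ≤-trans; *-mono-≤; module ≤-Reasoning)
  open import Data.Product.Properties using (≡-dec)
  open import Data.List.Membership.Propositional using (find)
  open import Data.List.Relation.Unary.All using (all?)
  open import Data.List.Relation.Unary.All.Properties using (¬All⇒Any¬)

  _≟ₚ_ : DecidableEquality (Point F)
  _≟ₚ_ = ≡-dec _≟_ _≟_

  Symmetry : Mat F → Set
  Symmetry θ = InSL₂ θ × (∀ p → E (act F θ p) ≡ E p)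

  InR⇒Symmetry : ∀ {θ} → InR F E θ → Symmetry θ
  InR⇒Symmetry {θ} (det≡1 , θE≡E) = det≡1 , λ p → ⇔→≡ (mk⇔ (backward p) (forward p))
    where
    forward : ∀ p → E p ≡ true → E (act F θ p) ≡ true
    forward p Ep = proj₂ (θE≡E (act F θ p)) (p , Ep , refl)
    backward : ∀ p → E (act F θ p) ≡ true → E p ≡ true
    backward p Eθp with proj₁ (θE≡E (act F θ p)) Eθp
    ... | x , Ex , θx≡θp = subst (λ t → E t ≡ true) (act-injective det≡1 θx≡θp) Ex

  Symmetry-adj : ∀ {θ} → Symmetry θ → Symmetry (adj θ)
  Symmetry-adj {θ} (det≡1 , θE≡E) = trans (det-adj θ) det≡1 ,
    λ p → trans (sym (θE≡E (act F (adj θ) p))) (cong E (act-act-adj det≡1 p))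

  module _ (m₁ : ℕ) where

    Rich : Point F → Set
    Rich p = ∃ λ ℓ → MeetsExactly F E m₁ ℓ × (E p ≡ true × ¬ p ≡ origin F × OnLine F ℓ p)

    Rich-size : ∀ {m₀} → HasSize (MeetsExactly F E m₁) m₀ → HasSize Rich (m₀ * m₁)
    Rich-size = HasSize-⋃ (λ (_ , p≢0 , p∈ℓ) (_ , _ , p∈ℓ′) → OnLine-unique _ _ p∈ℓ p∈ℓ′ p≢0)

    Symmetry-Rich : ∀ {θ p} → Symmetry θ → Rich p → Rich (act F θ p)
    Symmetry-Rich {θ} {p} θ-sym@(det≡1 , θE≡E) (ℓ , meets , Ep , p≢0 , p∈ℓ) =
      lineOf (act F θ p) ,
      HasSize-image (act F θ) (act F (adj θ)) (act-adj-act det≡1) (act-act-adj det≡1) forward backward meets ,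
      trans (θE≡E p) Ep , act-≢origin det≡1 p≢0 , OnLine-lineOf (act F θ p)
      where
      adj-det≡1 : InSL₂ (adj θ)
      adj-det≡1 = proj₁ (Symmetry-adj θ-sym)
      adjE≡E : ∀ q → E (act F (adj θ) q) ≡ E q
      adjE≡E = proj₂ (Symmetry-adj θ-sym)
      forward : ∀ {q} → E q ≡ true × ¬ q ≡ origin F × OnLine F ℓ q →
        E (act F θ q) ≡ true × ¬ act F θ q ≡ origin F × OnLine F (lineOf (act F θ p)) (act F θ q)
      forward {q} (Eq , q≢0 , q∈ℓ) =
        trans (θE≡E q) Eq , act-≢origin det≡1 q≢0 , OnLine-act det≡1 p∈ℓ p≢0 (OnLine-lineOf (act F θ p)) q∈ℓ
      backward : ∀ {q} → E q ≡ true × ¬ q ≡ origin F × OnLine F (lineOf (act F θ p)) q →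
        E (act F (adj θ) q) ≡ true × ¬ act F (adj θ) q ≡ origin F × OnLine F ℓ (act F (adj θ) q)
      backward {q} (Eq , q≢0 , q∈ℓ′) =
        trans (adjE≡E q) Eq , act-≢origin adj-det≡1 q≢0 ,
        OnLine-act adj-det≡1 (OnLine-lineOf (act F θ p)) (act-≢origin det≡1 p≢0)
          (subst (OnLine F ℓ) (sym (act-adj-act det≡1 p)) p∈ℓ) q∈ℓ′

    Rich⇒MeetsExactly-lineOf : ∀ {p} → Rich p → MeetsExactly F E m₁ (lineOf p)
    Rich⇒MeetsExactly-lineOf {p} (ℓ , meets , _ , p≢0 , p∈ℓ) =
      subst (MeetsExactly F E m₁) (OnLine-unique ℓ (lineOf p) p∈ℓ (OnLine-lineOf p) p≢0) meets

    point-on : ∀ {ℓ} → 1 ≤ m₁ → MeetsExactly F E m₁ ℓ → ∃ λ p → E p ≡ true × ¬ p ≡ origin F × OnLine F ℓ p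
    point-on 1≤m₁ ([]    , _ , 0≡m₁ , _)   = ⊥-elim (<⇒≢ 1≤m₁ 0≡m₁)
    point-on _    (p ∷ _ , _ , _    , mem) = p , proj₂ (mem p) (here refl)

    module _ {m₀ : ℕ} (lines : HasSize (MeetsExactly F E m₁) m₀) where
      open Enumeration lines using ()
        renaming (elements to ls; unique-elements to unique-ls; length-elements to length-ls;
                  ∈-elements to ∈-ls; elements-∈ to ls-∈)
      open Enumeration (Rich-size lines) using ()
        renaming (elements to richs; length-elements to length-richs; ∈-elements to ∈-richs)

      two-rich-points : 2 ≤ m₀ → 1 ≤ m₁ → ∃₂ λ u v → Rich u × Rich v × Independent u v
      two-rich-points 2≤m₀ 1≤m₁ with two-distinct unique-ls (subst (2 ≤_) (sym length-ls) 2≤m₀)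
      ... | ℓ₁ , ℓ₂ , ℓ₁∈ , ℓ₂∈ , ℓ₁≢ℓ₂ with point-on 1≤m₁ (ls-∈ ℓ₁∈) | point-on 1≤m₁ (ls-∈ ℓ₂∈)
      ...   | u , u-on@(_ , u≢0 , u∈ℓ₁) | v , v-on@(_ , v≢0 , v∈ℓ₂) =
        u , v , (ℓ₁ , ls-∈ ℓ₁∈ , u-on) , (ℓ₂ , ls-∈ ℓ₂∈ , v-on) ,
        λ uv≡0 → ℓ₁≢ℓ₂ (OnLine-unique ℓ₁ ℓ₂ (cross-OnLine ℓ₁ u∈ℓ₁ u≢0 uv≡0) v∈ℓ₂ v≢0)

      line-preserving-bound : ∀ {u v} → Rich u → Rich v → Independent u v → ∀ {θs} → Unique θs → All Symmetry θs →
        All (λ θ → cross u (act F θ u) ≡ 0#) θs → length θs ≤ m₀ * m₁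
      line-preserving-bound {u} {v} (ℓᵤ , meetsᵤ , Eu , u≢0 , u∈ℓᵤ) v-rich u∦v {θs} unique-θs syms fixes = begin
        length θs                          ≤⟨ length-≤-injection f unique-θs into injective ⟩
        length (cartesianProduct ls us)    ≡⟨ length-cartesianProduct ls us ⟩
        length ls * length us              ≡⟨ cong₂ _*_ length-ls length-us ⟩
        m₀ * m₁                            ∎
        where
        open ≤-Reasoning
        open Enumeration meetsᵤ using () renaming (elements to us; length-elements to length-us; ∈-elements to ∈-us)
        f : Mat F → Line F × Point F
        f θ = lineOf (act F θ v) , act F θ u
        into : ∀ {θ} → θ ∈ θs → f θ ∈ cartesianProduct ls us
        into θ∈ = let θ-sym@(det≡1 , θE≡E) = All.lookup syms θ∈ in ∈-cartesianProduct⁺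
          (∈-ls (Rich⇒MeetsExactly-lineOf (Symmetry-Rich θ-sym v-rich)))
          (∈-us (trans (θE≡E u) Eu , act-≢origin det≡1 u≢0 , cross-OnLine ℓᵤ u∈ℓᵤ u≢0 (All.lookup fixes θ∈)))
        injective : ∀ {θ θ′} → θ ∈ θs → θ′ ∈ θs → f θ ≡ f θ′ → θ ≡ θ′
        injective {θ} {θ′} θ∈ θ′∈ fθ≡fθ′ =
          SL₂-≡-from-point-and-direction u∦v (proj₁ (All.lookup syms θ∈)) (proj₁ (All.lookup syms θ′∈))
            (cong proj₂ fθ≡fθ′)
            (OnLine-cross (lineOf (act F θ v)) (OnLine-lineOf (act F θ v))
              (subst (λ ℓ → OnLine F ℓ (act F θ′ v)) (sym (cong proj₁ fθ≡fθ′)) (OnLine-lineOf (act F θ′ v))))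

      fibre-bound : ∀ {u g} → Rich u → Symmetry g → Independent u (act F g u) →
        ∀ {y θ₁ rest} → Unique (θ₁ ∷ rest) → All (λ θ → Symmetry θ × act F θ u ≡ y) (θ₁ ∷ rest) →
        length (θ₁ ∷ rest) * length rest ≤ m₀ * m₁
      fibre-bound {u} {g} u-rich g-sym u∦gu {y} {θ₁} {rest} unique@(θ₁∉rest ∷ unique-rest) fibre = begin
        length (θ₁ ∷ rest) * length rest             ≡⟨ length-cartesianProduct (θ₁ ∷ rest) rest ⟨
        length (cartesianProduct (θ₁ ∷ rest) rest)   ≤⟨ length-≤-injection Q (cartesianProduct⁺ unique unique-rest)
                                                          into injective ⟩
        length richs                                 ≡⟨ length-richs ⟩
        m₀ * m₁                                      ∎
        where
        open ≤-Reasoning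
        open Fibre u∦gu y
        z : Point F
        z = act F g u
        symmetry : ∀ {θ} → θ ∈ θ₁ ∷ rest → Symmetry θ
        symmetry θ∈ = proj₁ (All.lookup fibre θ∈)
        in-fibre : ∀ {θ} → θ ∈ θ₁ ∷ rest → InFibre θ
        in-fibre θ∈ = proj₁ (symmetry θ∈) , proj₂ (All.lookup fibre θ∈)
        h : Point F → Point F
        h w = act F (adj g) (act F (adj θ₁) w)
        h-cross : ∀ p q → cross (h p) (h q) ≡ cross p q
        h-cross p q = trans (cross-SL₂ (proj₁ (Symmetry-adj g-sym)) _ _)
                            (cross-SL₂ (proj₁ (Symmetry-adj (symmetry (here refl)))) p q)
        hθ₁z≡u : h (act F θ₁ z) ≡ u
        hθ₁z≡u = trans (cong (act F (adj g)) (act-adj-act (proj₁ (symmetry (here refl))) z))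
                       (act-adj-act (proj₁ g-sym) u)
        Q : Mat F × Mat F → Point F
        Q (θ , φ) = act F θ (h (act F φ z))
        into : ∀ {x} → x ∈ cartesianProduct (θ₁ ∷ rest) rest → Q x ∈ richs
        into x∈ = let θ∈ , φ∈ = ∈-cartesianProduct⁻ (θ₁ ∷ rest) rest x∈ in ∈-richs
          (Symmetry-Rich (symmetry θ∈) (Symmetry-Rich (Symmetry-adj g-sym)
            (Symmetry-Rich (Symmetry-adj (symmetry (here refl)))
              (Symmetry-Rich (symmetry (there φ∈)) (Symmetry-Rich g-sym u-rich)))))
        injective : ∀ {x x′} → x ∈ cartesianProduct (θ₁ ∷ rest) rest → x′ ∈ cartesianProduct (θ₁ ∷ rest) rest →
          Q x ≡ Q x′ → x ≡ x′
        injective x∈ x′∈ Qx≡Qx′ =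
          let θ∈ , φ∈   = ∈-cartesianProduct⁻ (θ₁ ∷ rest) rest x∈
              θ′∈ , φ′∈ = ∈-cartesianProduct⁻ (θ₁ ∷ rest) rest x′∈
              θ≡θ′ , φ≡φ′ = pair-injective (in-fibre (here refl)) h-cross hθ₁z≡u
                (in-fibre θ∈) (in-fibre θ′∈) (in-fibre (there φ∈)) (in-fibre (there φ′∈))
                (λ φ≡θ₁ → All.lookup θ₁∉rest φ∈ (sym φ≡θ₁)) Qx≡Qx′
          in cong₂ _,_ θ≡θ′ φ≡φ′

      private
        N : ℕ
        N = m₀ * m₁

      moving-bound : ∀ {u g} → Rich u → Symmetry g → Independent u (act F g u) → 1 ≤ N →
        ∀ {θs} → Unique θs → All Symmetry θs → length θs * length θs ≤ (N * N) * (N + N)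
      moving-bound {u} u-rich g-sym u∦gu 1≤N {θs} unique-θs syms =
        subst (λ n → length θs * length θs ≤ (n * n) * (N + N)) length-richs
          (length²-≤-fibres _≟ₚ_ orbit θs richs into fibre²-bound)
        where
        orbit : Mat F → Point F
        orbit θ = act F θ u
        into : ∀ {θ} → θ ∈ θs → orbit θ ∈ richs
        into θ∈ = ∈-richs (Symmetry-Rich (All.lookup syms θ∈) u-rich)
        square-bound : ∀ {y} fs → Unique fs → All (λ θ → Symmetry θ × act F θ u ≡ y) fs →
          length fs * length fs ≤ N + N
        square-bound []          _      _     = z≤n
        square-bound (θ₁ ∷ rest) unique fibre =
          [1+r]*r≤n⇒[1+r]*[1+r]≤n+n {length rest} 1≤N (fibre-bound u-rich g-sym u∦gu unique fibre)
        fibre²-bound : ∀ y → length (fibre _≟ₚ_ orbit θs y) * length (fibre _≟ₚ_ orbit θs y) ≤ N + N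
        fibre²-bound y = square-bound _ (filter⁺ _ unique-θs) (All.tabulate λ θ∈ →
          let (θ∈θs , θu≡y) = ∈-filter⁻ _ θ∈ in All.lookup syms θ∈θs , θu≡y)

      symmetries-square-bound : ∀ {u v} → Rich u → Rich v → Independent u v → 1 ≤ N → ∀ {θs} → Unique θs →
        All Symmetry θs → Dec (All (λ θ → cross u (act F θ u) ≡ 0#) θs) →
        length θs * length θs ≤ (N * N) * (N + N)
      symmetries-square-bound u-rich v-rich u∦v 1≤N unique-θs syms (yes fixes) =
        m≤n⇒m*m≤n*n*[n+n] 1≤N (line-preserving-bound u-rich v-rich u∦v unique-θs syms fixes)
      symmetries-square-bound {u} u-rich v-rich u∦v 1≤N {θs} unique-θs syms (no ¬fixes) =
        let g , g∈θs , u∦gu = find (¬All⇒Any¬ (λ θ → cross u (act F θ u) ≟ 0#) θs ¬fixes)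
        in moving-bound u-rich (All.lookup syms g∈θs) u∦gu 1≤N unique-θs syms

      symmetries-bound : 2 ≤ m₀ → 1 ≤ m₁ → ∀ {θs} → Unique θs → All Symmetry θs → length θs ^ 2 ≤ 2 * N ^ 3
      symmetries-bound 2≤m₀ 1≤m₁ {θs} unique-θs syms =
        let u , v , u-rich , v-rich , u∦v = two-rich-points 2≤m₀ 1≤m₁
            1≤N = *-mono-≤ (≤-trans (s≤s z≤n) 2≤m₀) 1≤m₁
        in m*m≤n*n*[n+n]⇒m^2≤2*n^3 {length θs} {N} (symmetries-square-bound u-rich v-rich u∦v 1≤N unique-θs syms
             (all? (λ θ → cross u (act F θ u) ≟ 0#) θs))

open import Data.Nat using (ℕ; _+_; _*_; _^_; _≤_; _<_; z≤n; s≤s)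
open import Data.Nat.Properties using (≤-trans; *-monoˡ-≤; *-monoʳ-≤; ^-monoˡ-≤)
open Counting using (HasSize-mono)

proposition2p5 : ∃ λ (c : ℕ) → 1 ≤ c ×
    (∀ (F : FiniteField) (E : Subset F) (m₁ : ℕ) → 1 ≤ m₁ →
    (m₀ : ℕ) → HasSize (MeetsExactly F E m₁) m₀ → 8 + 4 * c < m₀ →
    (∀ (θs : List (Mat F)) → Unique θs → All (InR F E) θs →
    length θs ^ 2 ≤ 256 * c ^ 4 * (m₀ * m₁) ^ 3)
    × (∀ (n : ℕ) → HasSize (λ p → E p ≡ true) n →
    ∀ (θs : List (Mat F)) → Unique θs → All (InR F E) θs →
    length θs ^ 2 ≤ 256 * c ^ 4 * n ^ 3))
proposition2p5 = 1 , s≤s z≤n , λ F E m₁ 1≤m₁ m₀ lines 12<m₀ →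
  let open Symmetries F E
      bound : ∀ θs → Unique θs → All (InR F E) θs → length θs ^ 2 ≤ 256 * (m₀ * m₁) ^ 3
      bound θs unique Rθs = ≤-trans
        (symmetries-bound m₁ lines (≤-trans (s≤s (s≤s z≤n)) 12<m₀) 1≤m₁ unique (All.map InR⇒Symmetry Rθs))
        (*-monoˡ-≤ ((m₀ * m₁) ^ 3) {2} {256} (s≤s (s≤s z≤n)))
      N≤|E| : ∀ {n} → HasSize (λ p → E p ≡ true) n → m₀ * m₁ ≤ n
      N≤|E| E-size = HasSize-mono (λ (_ , _ , Ep , _) → Ep) (Rich-size m₁ lines) E-size
  in bound , λ n E-size θs unique Rθs →
       ≤-trans (bound θs unique Rθs) (*-monoʳ-≤ 256 (^-monoˡ-≤ 3 (N≤|E| E-size)))
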